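{- Suppose that for every integer $r\geq 3$, every $r$-graph has $2r$ 1-factors such that each edge is contained in precisely two of them. Then for all integers $r$ and $k$ with $r\geq 3$ and $1\leq k\leq 2r-1$, $$m(r,k)\geq 1-\prod_{i=1}^k \frac{2r-1-i}{2r+1-i}.$$
   Context: For a graph $G$ and $S\subseteq V(G)$, $\partial S$ denotes the set of edges of $G$ with exactly one end in $S$. For a positive integer $r$, an $r$-graph is an $r$-regular graph $G$ such that $|\partial S|\geq r$ for every $S\subseteq V(G)$ of odd cardinality. A 1-factor is a perfect matching; a family of $2r$ 1-factors may contain repetitions. For an $r$-graph $G$ with set $\mathcal{M}$ of 1-factors and a positive integer $k$, define $m(r,k,G)=\max_{M_1,\ldots,M_k\in\mathcal{M}} \frac{|\bigcup_{i=1}^k M_i|}{|E(G)|}$ (the $M_i$ need not be distinct), and $m(r,k)=\inf_G m(r,k,G)$, the infimum taken over all $r$-graphs $G$. -}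

module Defs where

open import Data.Nat using (ℕ; zero; suc; _+_; _*_; _∸_; _≤_; _%_)
open import Data.Bool using (Bool; _∨_; _xor_)
open import Data.Fin using (Fin)
open import Data.Fin.Properties using (_≟_)
open import Data.Fin.Subset using (Subset; ∣_∣; _∩_; ⋃)
open import Data.Vec using (Vec; tabulate; lookup; toList)
open import Data.Product using (_×_; proj₁; proj₂)
open import Relation.Binary.PropositionalEquality using (_≡_; _≢_)
open import Relation.Nullary.Decidable using (⌊_⌋)

record Graph : Set where
  field
    n     : ℕ
    m     : ℕ
    ends  : Fin m → Fin n × Fin n
    loopless : ∀ e → proj₁ (ends e) ≢ proj₂ (ends e)

module _ (G : Graph) where
  open Graph G

  incidentSet : Fin n → Subset m
  incidentSet v = tabulate λ e → ⌊ proj₁ (ends e) ≟ v ⌋ ∨ ⌊ proj₂ (ends e) ≟ v ⌋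

  degree : Fin n → ℕ
  degree v = ∣ incidentSet v ∣

  ∂ : Subset n → Subset m
  ∂ S = tabulate λ e → lookup S (proj₁ (ends e)) xor lookup S (proj₂ (ends e))

  IsRGraph : ℕ → Set
  IsRGraph r = (∀ v → degree v ≡ r) × (∀ (S : Subset n) → ∣ S ∣ % 2 ≡ 1 → r ≤ ∣ ∂ S ∣)

  IsOneFactor : Subset m → Set
  IsOneFactor M = ∀ v → ∣ M ∩ incidentSet v ∣ ≡ 1

  multiplicity : ∀ {t} → Vec (Subset m) t → Fin m → ℕ
  multiplicity Ms e = ∣ tabulate (λ j → lookup (lookup Ms j) e) ∣

  unionSize : ∀ {k} → Vec (Subset m) k → ℕ
  unionSize Ms = ∣ ⋃ (toList Ms) ∣

prod : ℕ → (ℕ → ℕ) → ℕ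
prod zero    f = 1
prod (suc k) f = prod k f * f (suc k)

-- Pick k of the 2r perfect matchings uniformly at random and without repetition. An edge
-- lying in exactly two of them is missed with probability ∏ᵢ (2r−1−i)/(2r+1−i), so some
-- choice misses at most that fraction of the edges. Deterministically: for a family of t
-- sets in which an edge lies in c of them, the ordered j-selections missing it number
-- (t ∸ c) P′ j, and conditioning on the first choice (an averaging step) lets the sets be
-- chosen one at a time while keeping the count of missed pairs below its mean.
module Submission where

open import Defs
open import Data.Nat using (ℕ; zero; suc; _+_; _*_; _∸_; _≤_; s≤s)
open import Data.Nat.Properties
open import Data.Nat.Combinatorics.Base using (_P′_)
open import Data.Bool using (Bool; true; false; if_then_else_; _∨_)
open import Data.Fin using (Fin; zero; suc; punchIn)
open import Data.Fin.Subset using (Subset; ∣_∣; _∪_; ⋃; ⊥)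
open import Data.Fin.Subset.Properties using (∪-assoc; ∪-identityˡ; ∪-identityʳ)
open import Data.Vec using (Vec; []; _∷_; lookup; tabulate; toList)
open import Data.Vec.Properties using (lookup-zipWith; lookup-replicate; lookup∘tabulate)
open import Data.Vec.Functional using (removeAt)
open import Data.Product using (_×_; Σ; Σ-syntax; _,_; ∃-syntax)
open import Relation.Binary.PropositionalEquality
open import Relation.Nullary using (yes; no)
open import Algebra.Properties.CommutativeSemigroup *-commutativeSemigroup using (x∙yz≈y∙xz)
open import Algebra.Properties.Semiring.Sum +-*-semiring
  using (sum-syntax; sum-cong-≗; sum-remove; ∑-comm; ∑-distrib-+; *-distribʳ-sum)

P′-suc : ∀ a j → a P′ suc j ≡ a * ((a ∸ 1) P′ j)
P′-suc a zero    = refl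
P′-suc a (suc j) = begin
  (a ∸ suc j) * (a P′ suc j)          ≡⟨ cong ((a ∸ suc j) *_) (P′-suc a j) ⟩
  (a ∸ suc j) * (a * ((a ∸ 1) P′ j))  ≡⟨ x∙yz≈y∙xz (a ∸ suc j) a _ ⟩
  a * ((a ∸ suc j) * ((a ∸ 1) P′ j))  ≡⟨ cong (λ d → a * (d * ((a ∸ 1) P′ j))) (∸-+-assoc a 1 j) ⟨
  a * ((a ∸ 1 ∸ j) * ((a ∸ 1) P′ j))  ∎
  where open ≡-Reasoning

prod-∸≡P′ : ∀ {a b} → b ≡ suc a → ∀ k → prod k (λ i → b ∸ i) ≡ a P′ k
prod-∸≡P′     refl zero    = refl
prod-∸≡P′ {a} refl (suc k) = trans (cong (_* (a ∸ k)) (prod-∸≡P′ refl k)) (*-comm _ (a ∸ k))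

complement-bound : ∀ {m} s u {A B} → s + u ≡ m → u * A ≤ m * B → m * (A ∸ B) ≤ s * A
complement-bound {m} s u {A} {B} s+u≡m uA≤mB = begin
  m * (A ∸ B)      ≡⟨ *-distribˡ-∸ m A B ⟩
  m * A ∸ m * B    ≤⟨ ∸-monoʳ-≤ (m * A) uA≤mB ⟩
  m * A ∸ u * A    ≡⟨ *-distribʳ-∸ A m u ⟨
  (m ∸ u) * A      ≡⟨ cong (λ n → (n ∸ u) * A) s+u≡m ⟨
  (s + u ∸ u) * A  ≡⟨ cong (_* A) (m+n∸n≡m s u) ⟩
  s * A            ∎
  where open ≤-Reasoning

∑-const : ∀ n c → ∑[ i < n ] c ≡ n * c
∑-const zero    c = refl
∑-const (suc n) c = cong (c +_) (∑-const n c)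

∑-average : ∀ {n} (f : Fin (suc n) → ℕ) → ∃[ i ] suc n * f i ≤ ∑[ k < suc n ] f k
∑-average {zero}  f = zero , ≤-refl
∑-average {suc n} f with ∑-average (λ k → f (suc k))
... | i , bound with f zero ≤? f (suc i)
...   | yes f₀≤fᵢ = zero , +-monoʳ-≤ (f zero) (≤-trans (*-monoʳ-≤ (suc n) f₀≤fᵢ) bound)
...   | no  f₀≰fᵢ = suc i , +-mono-≤ (<⇒≤ (≰⇒> f₀≰fᵢ)) bound

∑-indicator-complement : ∀ {n} (f : Fin n → Bool) →
  ∑[ i < n ] (if f i then 1 else 0) + ∑[ i < n ] (if f i then 0 else 1) ≡ n
∑-indicator-complement {n} f = begin
  ∑[ i < n ] (if f i then 1 else 0) + ∑[ i < n ] (if f i then 0 else 1)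
    ≡⟨ ∑-distrib-+ (λ i → if f i then 1 else 0) (λ i → if f i then 0 else 1) ⟨
  ∑[ i < n ] ((if f i then 1 else 0) + (if f i then 0 else 1))
    ≡⟨ sum-cong-≗ (λ i → indicators-sum (f i)) ⟩
  ∑[ i < n ] 1
    ≡⟨ trans (∑-const n 1) (*-identityʳ n) ⟩
  n ∎
  where
  open ≡-Reasoning
  indicators-sum : ∀ b → (if b then 1 else 0) + (if b then 0 else 1) ≡ 1
  indicators-sum true  = refl
  indicators-sum false = refl

∣p∣≡∑ : ∀ {n} (p : Subset n) → ∣ p ∣ ≡ ∑[ i < n ] (if lookup p i then 1 else 0)
∣p∣≡∑ []          = refl
∣p∣≡∑ (true  ∷ p) = cong suc (∣p∣≡∑ p)
∣p∣≡∑ (false ∷ p) = ∣p∣≡∑ p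

∣tabulate∣≡∑ : ∀ {n} (f : Fin n → Bool) → ∣ tabulate f ∣ ≡ ∑[ i < n ] (if f i then 1 else 0)
∣tabulate∣≡∑ f =
  trans (∣p∣≡∑ (tabulate f)) (sum-cong-≗ λ i → cong (λ b → if b then 1 else 0) (lookup∘tabulate f i))

lookup-∪ : ∀ {n} (p q : Subset n) i → lookup (p ∪ q) i ≡ lookup p i ∨ lookup q i
lookup-∪ p q i = lookup-zipWith _∨_ i p q

_⊑_ : ∀ {A : Set} {j t} → Vec A j → (Fin t → A) → Set
Q ⊑ P = ∀ i → ∃[ k ] lookup Q i ≡ P k

module _ {m : ℕ} where

  occurrences : ∀ {t} → (Fin t → Subset m) → Fin m → ℕ
  occurrences {t} P e = ∑[ i < t ] (if lookup (P i) e then 1 else 0)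

  uncovered : Subset m → ℕ
  uncovered U = ∑[ e < m ] (if lookup U e then 0 else 1)

  -- The number of pairs (e, s) with e ∉ U and s an ordered selection of j distinct
  -- indices of P none of whose sets contains e. For j = 0 it is uncovered U.
  weight : ∀ {t} → ℕ → Subset m → (Fin t → Subset m) → ℕ
  weight {t} j U P = ∑[ e < m ] (if lookup U e then 0 else (t ∸ occurrences P e) P′ j)

  ∣U∣+uncovered≡m : ∀ U → ∣ U ∣ + uncovered U ≡ m
  ∣U∣+uncovered≡m U = trans (cong (_+ uncovered U) (∣p∣≡∑ U)) (∑-indicator-complement (lookup U))

  occurrences-removeAt : ∀ {t} (P : Fin (suc t) → Subset m) i e → lookup (P i) e ≡ false →
    occurrences (removeAt P i) e ≡ occurrences P e
  occurrences-removeAt P i e e∉Pᵢ =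
    sym (trans (sum-remove {i = i} (λ k → if lookup (P k) e then 1 else 0))
               (cong (λ b → (if b then 1 else 0) + occurrences (removeAt P i) e) e∉Pᵢ))

  -- Removing a set that misses e does not change the number of sets containing e, so every
  -- such first choice leaves the same number of continuations.
  first-choices-missing : ∀ {t} (P : Fin (suc t) → Subset m) j e →
    ∑[ i < suc t ] (if lookup (P i) e then 0 else (t ∸ occurrences (removeAt P i) e) P′ j)
      ≡ (suc t ∸ occurrences P e) P′ suc j
  first-choices-missing {t} P j e = begin
    ∑[ i < suc t ] (if lookup (P i) e then 0 else (t ∸ occurrences (removeAt P i) e) P′ j)
      ≡⟨ sum-cong-≗ summand ⟩
    ∑[ i < suc t ] ((if lookup (P i) e then 0 else 1) * K)
      ≡⟨ *-distribʳ-sum K (λ i → if lookup (P i) e then 0 else 1) ⟨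
    ∑[ i < suc t ] (if lookup (P i) e then 0 else 1) * K
      ≡⟨ cong (_* K) misses ⟩
    (suc t ∸ c) * K
      ≡⟨ cong (λ a → (suc t ∸ c) * (a P′ j)) one-fewer ⟨
    (suc t ∸ c) * ((suc t ∸ c ∸ 1) P′ j)
      ≡⟨ P′-suc (suc t ∸ c) j ⟨
    (suc t ∸ c) P′ suc j ∎
    where
    open ≡-Reasoning
    c = occurrences P e
    K = (t ∸ c) P′ j
    one-fewer : suc t ∸ c ∸ 1 ≡ t ∸ c
    one-fewer = trans (∸-+-assoc (suc t) c 1) (cong (suc t ∸_) (+-comm c 1))
    summand : ∀ i → (if lookup (P i) e then 0 else (t ∸ occurrences (removeAt P i) e) P′ j)
                      ≡ (if lookup (P i) e then 0 else 1) * K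
    summand i with lookup (P i) e in e∉Pᵢ
    ... | true  = refl
    ... | false =
      trans (cong (λ o → (t ∸ o) P′ j) (occurrences-removeAt P i e e∉Pᵢ)) (sym (+-identityʳ K))
    misses : ∑[ i < suc t ] (if lookup (P i) e then 0 else 1) ≡ suc t ∸ c
    misses = trans (sym (m+n∸m≡n c _)) (cong (_∸ c) (∑-indicator-complement (λ i → lookup (P i) e)))

  weight-first-choice : ∀ {t} j (P : Fin (suc t) → Subset m) U →
    ∑[ i < suc t ] weight j (U ∪ P i) (removeAt P i) ≡ weight (suc j) U P
  weight-first-choice {t} j P U =
    trans (∑-comm (λ i e → if lookup (U ∪ P i) e then 0 else continuations i e)) (sum-cong-≗ per-edge)
    where
    continuations : Fin (suc t) → Fin m → ℕ
    continuations i e = (t ∸ occurrences (removeAt P i) e) P′ j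
    per-edge : ∀ e → ∑[ i < suc t ] (if lookup (U ∪ P i) e then 0 else continuations i e)
                       ≡ (if lookup U e then 0 else (suc t ∸ occurrences P e) P′ suc j)
    per-edge e =
      trans (sum-cong-≗ λ i → cong (λ b → if b then 0 else continuations i e) (lookup-∪ U (P i) e))
            (by-coverage (lookup U e))
      where
      by-coverage : ∀ b → ∑[ i < suc t ] (if b ∨ lookup (P i) e then 0 else continuations i e)
                            ≡ (if b then 0 else (suc t ∸ occurrences P e) P′ suc j)
      by-coverage true  = trans (∑-const (suc t) 0) (*-zeroʳ (suc t))
      by-coverage false = first-choices-missing P j e

  select : ∀ {t} j (P : Fin t → Subset m) U → j ≤ t →
    Σ[ Q ∈ Vec (Subset m) j ] Q ⊑ P × uncovered (U ∪ ⋃ (toList Q)) * (t P′ j) ≤ weight j U P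
  select zero P U _ =
    [] , (λ ()) , ≤-reflexive (trans (*-identityʳ (uncovered (U ∪ ⊥))) (cong uncovered (∪-identityʳ U)))
  select {suc t} (suc j) P U (s≤s j≤t) with ∑-average (λ i → weight j (U ∪ P i) (removeAt P i))
  ... | i , average with select j (removeAt P i) (U ∪ P i) j≤t
  ... | Q , Q⊑P∖i , bound = P i ∷ Q , P∷Q⊑P , (begin
    uncovered (U ∪ (P i ∪ R)) * (suc t P′ suc j)
      ≡⟨ cong₂ (λ V n → uncovered V * n) (sym (∪-assoc U (P i) R)) (P′-suc (suc t) j) ⟩
    uncovered ((U ∪ P i) ∪ R) * (suc t * (t P′ j))
      ≡⟨ x∙yz≈y∙xz (uncovered ((U ∪ P i) ∪ R)) (suc t) (t P′ j) ⟩
    suc t * (uncovered ((U ∪ P i) ∪ R) * (t P′ j))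
      ≤⟨ *-monoʳ-≤ (suc t) bound ⟩
    suc t * weight j (U ∪ P i) (removeAt P i)
      ≤⟨ average ⟩
    ∑[ k < suc t ] weight j (U ∪ P k) (removeAt P k)
      ≡⟨ weight-first-choice j P U ⟩
    weight (suc j) U P ∎)
    where
    open ≤-Reasoning
    R = ⋃ (toList Q)
    P∷Q⊑P : (P i ∷ Q) ⊑ P
    P∷Q⊑P zero    = i , refl
    P∷Q⊑P (suc k) with Q⊑P∖i k
    ... | k′ , eq = punchIn i k′ , eq

  weight-⊥ : ∀ {t} j c (P : Fin t → Subset m) → (∀ e → occurrences P e ≡ c) →
    weight j ⊥ P ≡ m * ((t ∸ c) P′ j)
  weight-⊥ {t} j c P occ≡c = trans (sum-cong-≗ constant) (∑-const m _)
    where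
    constant : ∀ e → (if lookup ⊥ e then 0 else (t ∸ occurrences P e) P′ j) ≡ (t ∸ c) P′ j
    constant e rewrite lookup-replicate e false | occ≡c e = refl

  covering-bound : ∀ {t} j c (P : Fin t → Subset m) → j ≤ t → (∀ e → occurrences P e ≡ c) →
    Σ[ Q ∈ Vec (Subset m) j ] Q ⊑ P × m * (t P′ j ∸ (t ∸ c) P′ j) ≤ ∣ ⋃ (toList Q) ∣ * (t P′ j)
  covering-bound {t} j c P j≤t occ≡c with select j P ⊥ j≤t
  ... | Q , Q⊑P , bound = Q , Q⊑P , complement-bound ∣ R ∣ (uncovered R) (∣U∣+uncovered≡m R) missed
    where
    R = ⋃ (toList Q)
    missed : uncovered R * (t P′ j) ≤ m * ((t ∸ c) P′ j)
    missed = subst₂ (λ V w → uncovered V * (t P′ j) ≤ w) (∪-identityˡ R) (weight-⊥ j c P occ≡c) bound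

mainTheorem4 :
  ((r : ℕ) → 3 ≤ r → (G : Graph) → IsRGraph G r →
    Σ (Vec (Subset (Graph.m G)) (2 * r)) λ Ms →
      ((j : Fin (2 * r)) → IsOneFactor G (lookup Ms j)) ×
      ((e : Fin (Graph.m G)) → multiplicity G Ms e ≡ 2)) →
  (r k : ℕ) → 3 ≤ r → 1 ≤ k → k ≤ 2 * r ∸ 1 →
  (G : Graph) → IsRGraph G r →
    Σ (Vec (Subset (Graph.m G)) k) λ Ms →
      ((j : Fin k) → IsOneFactor G (lookup Ms j)) ×
      (Graph.m G * (prod k (λ i → 2 * r + 1 ∸ i) ∸ prod k (λ i → 2 * r ∸ 1 ∸ i))
        ≤ unionSize G Ms * prod k (λ i → 2 * r + 1 ∸ i))
mainTheorem4 hyp r k 3≤r _ k≤2r∸1 G rg with hyp r 3≤r G rg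
... | Ms , Ms-factors , Ms-double
    with covering-bound k 2 (lookup Ms) (≤-trans k≤2r∸1 (m∸n≤m (2 * r) 1))
           (λ e → trans (sym (∣tabulate∣≡∑ (λ i → lookup (lookup Ms i) e))) (Ms-double e))
... | Q , Q⊑Ms , bound = Q , Q-factors ,
  subst₂ (λ A B → Graph.m G * (A ∸ B) ≤ unionSize G Q * A)
         (sym (prod-∸≡P′ (+-comm (2 * r) 1) k)) (sym (prod-∸≡P′ (+-∸-assoc 1 2≤2r) k)) bound
  where
  2≤2r : 2 ≤ 2 * r
  2≤2r = ≤-trans (≤-trans (n≤1+n 2) 3≤r) (m≤m+n r (r + 0))
  Q-factors : (j : Fin k) → IsOneFactor G (lookup Q j)
  Q-factors j with Q⊑Ms j
  ... | i , eq = subst (IsOneFactor G) (sym eq) (Ms-factors i)
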